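{- Let $m,n\ge1$ and let $(\mu,\nu)=(\mu_1,\dots,\mu_m,\nu_1,\dots,\nu_n)$ be positive integers with $\sum\mu_i=\sum\nu_j$, lying in a chamber of the resonance arrangement. Let $\varphi(1),\dots,\varphi(m+n)$ be the ordering of the parts of $\mu$ and $\nu$ defined below. Then $CP(\mu,\nu)$ (defined with the initial word below) consists of exactly one element if and only if $$\varphi(k)>\sum_{\ell>k,\ \ell\nsim k}\varphi(\ell)\quad\text{for all }2\le k\le m+n.$$
   Context: $[k]=\{1,\dots,k\}$, $|\mu_I|=\sum_{i\in I}\mu_i$. Chamber assumption: $|\mu_I|\ne|\nu_J|$ for all $I\subseteq[m]$, $J\subseteq[n]$ with $(I,J)\ne(\emptyset,\emptyset),([m],[n])$. Ordering $\varphi$: $\varphi(1)$ is the larger and $\varphi(2)$ the smaller of $\mu_1,\nu_1$; set $A_2=\{1\}\subseteq[m]$, $B_2=\{1\}\subseteq[n]$. For $k\ge2$ (while $k<m+n$): if $|\mu_{A_k}|>|\nu_{B_k}|$, let $\varphi(k+1)=\nu_{|B_k|+1}$, $B_{k+1}=B_k\cup\{|B_k|+1\}$, $A_{k+1}=A_k$; otherwise let $\varphi(k+1)=\mu_{|A_k|+1}$, $A_{k+1}=A_k\cup\{|A_k|+1\}$, $B_{k+1}=B_k$. Each $\varphi(k)$ is regarded as a part of $\mu$ or of $\nu$; write $k\nsim\ell$ if $\varphi(k)$ and $\varphi(\ell)$ are parts of different sequences ($\mu$ vs. $\nu$). Commutation patterns: let $e(I,J)=|\mu_I|-|\nu_J|$.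 A word is a sequence $((I_1,J_1),\dots,(I_k,J_k))$ with the $I_p$ pairwise disjoint with union $[m]$, the $J_p$ pairwise disjoint with union $[n]$. The initial word is $((\{m\},\emptyset),\dots,(\{2\},\emptyset),(\{1\},\emptyset),(\emptyset,\{1\}),(\emptyset,\{2\}),\dots,(\emptyset,\{n\}))$. For a word of length $k\ge2$, let $p$ be the largest index with $e(I_p,J_p)>0$; if $p=k$ the word is dead; otherwise, with $(K,L)=(I_{p+1},J_{p+1})$, it has a passing child (swap entries $p,p+1$) and a canceling child (replace them by $(I_p\cup K,J_p\cup L)$, recording $(I_p,J_p,K,L)$). A word of length 1 is successful. A commutation pattern is the sequence of $m+n-1$ recorded quadruples along a path from the initial word to a successful word; $CP(\mu,\nu)$ is the set of these. -}

module Defs where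

open import Data.Nat using (ℕ; zero; suc; _+_; _<_; _≤_; _<ᵇ_)
open import Data.Bool using (Bool; true; false; if_then_else_)
open import Data.Vec using (Vec; []; _∷_; toList)
open import Data.List using (List; []; _∷_; _++_; map; reverse; allFin; length; lookup; drop)
open import Data.List.Relation.Unary.All using (All)
open import Data.Fin using (Fin; toℕ)
open import Data.Fin.Subset using (Subset; _∪_; ⁅_⁆; ⊥; ⊤)
open import Data.Product using (_×_; _,_; proj₁; proj₂; Σ)
open import Relation.Binary.PropositionalEquality using (_≡_; _≢_)
open import Relation.Nullary using (¬_)

wt : ∀ {m} → Vec ℕ m → Subset m → ℕ
wt [] [] = 0
wt (x ∷ xs) (b ∷ s) = (if b then x else 0) + wt xs s

Chamber : ∀ {m n} → Vec ℕ m → Vec ℕ n → Set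
Chamber {m} {n} μ ν =
  (I : Subset m) (J : Subset n) →
  ¬ (I ≡ ⊥ × J ≡ ⊥) → ¬ (I ≡ ⊤ × J ≡ ⊤) → wt μ I ≢ wt ν J

data Side : Set where
  μside νside : Side

-- k ≁ ℓ : the parts come from different sequences
differ : Side → Side → Bool
differ μside μside = false
differ νside νside = false
differ μside νside = true
differ νside μside = true

-- go (remaining μ parts) (remaining ν parts) |μ_{A_k}| |ν_{B_k}|
-- produces φ(k+1), φ(k+2), … following the rule of the paper.
-- (The branches where the requested sequence is exhausted never occur
--  under the hypotheses; they just continue with the other sequence.)
go : List ℕ → List ℕ → ℕ → ℕ → List (Side × ℕ)
go [] [] sa sb = []
go [] (y ∷ ys) sa sb = (νside , y) ∷ go [] ys sa (sb + y)
go (x ∷ xs) [] sa sb = (μside , x) ∷ go xs [] (sa + x) sb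
go (x ∷ xs) (y ∷ ys) sa sb =
  if sb <ᵇ sa
  then (νside , y) ∷ go (x ∷ xs) ys sa (sb + y)
  else (μside , x) ∷ go xs (y ∷ ys) (sa + x) sb

phiList : List ℕ → List ℕ → List (Side × ℕ)
phiList (x ∷ xs) (y ∷ ys) =
  (if y <ᵇ x then (μside , x) ∷ (νside , y) ∷ []
             else (νside , y) ∷ (μside , x) ∷ []) ++ go xs ys x y
phiList _ _ = []

-- φ as a list: φ(1), …, φ(m+n)  (list position k-1 holds φ(k))
φ : ∀ {m n} → Vec ℕ m → Vec ℕ n → List (Side × ℕ)
φ μ ν = phiList (toList μ) (toList ν)

oppSum : Side → List (Side × ℕ) → ℕ
oppSum s [] = 0
oppSum s ((t , v) ∷ rest) = (if differ s t then v else 0) + oppSum s rest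

-- φ(k) > Σ_{ℓ > k, ℓ ≁ k} φ(ℓ) for all 2 ≤ k ≤ m+n
-- (list index i = k - 1, so 1 ≤ i)
PhiCondition : ∀ {m n} → Vec ℕ m → Vec ℕ n → Set
PhiCondition μ ν =
  (i : Fin (length (φ μ ν))) → 1 ≤ toℕ i →
  oppSum (proj₁ (lookup (φ μ ν) i)) (drop (suc (toℕ i)) (φ μ ν))
    < proj₂ (lookup (φ μ ν) i)

module Words {m n : ℕ} (μ : Vec ℕ m) (ν : Vec ℕ n) where

  Entry : Set
  Entry = Subset m × Subset n

  Word : Set
  Word = List Entry

  Pos : Entry → Set
  Pos (I , J) = wt ν J < wt μ I

  _∪ₑ_ : Entry → Entry → Entry
  (I , J) ∪ₑ (K , L) = (I ∪ K , J ∪ L)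

  Quad : Set
  Quad = Entry × Entry

  initialWord : Word
  initialWord = reverse (map (λ i → (⁅ i ⁆ , ⊥)) (allFin m))
             ++ map (λ j → (⊥ , ⁅ j ⁆)) (allFin n)

  -- A word  pre ++ a ∷ b ∷ post  with e(a) > 0 and no entry of b ∷ post
  -- positive has p = length pre + 1 as its largest positive index, p < k.
  data Reaches : Word → List Quad → Set where
    success : ∀ x → Reaches (x ∷ []) []
    passing : ∀ pre a b post {qs} →
      Pos a → All (λ e → ¬ Pos e) (b ∷ post) →
      Reaches (pre ++ b ∷ a ∷ post) qs →
      Reaches (pre ++ a ∷ b ∷ post) qs
    canceling : ∀ pre a b post {qs} →
      Pos a → All (λ e → ¬ Pos e) (b ∷ post) →
      Reaches (pre ++ (a ∪ₑ b) ∷ post) qs →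
      Reaches (pre ++ a ∷ b ∷ post) ((a , b) ∷ qs)

  CP : List Quad → Set
  CP qs = Reaches initialWord qs

CPSingleton : ∀ {m n} → Vec ℕ m → Vec ℕ n → Set
CPSingleton μ ν =
  Σ (List Quad) λ qs → CP qs × ((qs' : List Quad) → CP qs' → qs' ≡ qs)
  where open Words μ ν

-- Write W a b for the word (μ_m) … (μ_{a+1}) (μ_1 ∪ … ∪ μ_a ∪ ν_1 ∪ … ∪ ν_b) (ν_{b+1}) … (ν_n),
-- so that the initial word is W 1 0.  The last positive entry of W a b is either the block, which
-- then cancels with ν_{b+1}, or μ_{a+1}, which cancels with the block; this leads to W a (b+1) or
-- W (a+1) b exactly as φ prescribes.  The only other move is passing, and the condition on φ at
-- that position says precisely that the passed entry keeps e > 0 whatever it absorbs, so the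
-- passing child is dead.  If the condition fails, the chamber assumption makes the opposite
-- inequality strict, and canceling greedily from the passing child succeeds (the chamber
-- assumption again rules out a dead end of non-positive entries), giving a second pattern.

module Submission where

open import Defs

-- A separate module, so that All and sum in lemma4p4 below are those of vectors.
module CommutationPatterns where

  open import Data.Bool using (Bool; true; false; T; if_then_else_)
  open import Data.Empty using (⊥-elim) renaming (⊥ to Empty)
  open import Data.Fin using (Fin; toℕ; zero; suc; fromℕ<)
  open import Data.Fin.Properties using (toℕ-fromℕ<)
  open import Data.Fin.Subset using (Subset; _∪_; _∈_; _∉_; _⊆_; ⁅_⁆; ∁; ⊥; ⊤; inside; outside; Nonempty)
  open import Data.Fin.Subset.Properties
    using (∪-identityˡ; ∪-identityʳ; ∪-comm; ∪-assoc; x∈p∪q⁻; p⊆p∪q; q⊆p∪q; ∉⊥; ∈⊤;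
           x∈⁅x⁆; x∈⁅y⁆⇒x≡y; x∈p⇒x∉∁p; drop-∷-⊆; ⊆-trans; p∪∁p≡⊤)
  open import Data.List
    using (List; []; _∷_; _++_; _∷ʳ_; drop; length; lookup; tabulate; reverse; allFin; initLast; _∷ʳ′_)
  import Data.List
  open import Data.List.Properties using (∷-injective; ++-assoc; unfold-reverse; drop-all; length-tabulate; map-tabulate)
  open import Data.List.Relation.Unary.All using (All; []; _∷_)
  import Data.List.Relation.Unary.All as All
  open import Data.List.Relation.Unary.All.Properties using (++⁺; ++⁻ˡ; ++⁻ʳ; drop⁺; tabulate⁺)
  open import Data.Nat using (ℕ; zero; suc; _+_; _≤_; _<_; z≤n; s≤s; s≤s⁻¹; _<ᵇ_; _<?_; _≤?_)
  open import Data.Nat.ListAction using (sum)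
  open import Data.Nat.Properties
  open import Data.Product using (Σ; _×_; _,_; proj₁; proj₂)
  open import Data.Product.Properties using (,-injective)
  import Data.Product
  open import Data.Sum using (_⊎_; inj₁; inj₂; [_,_])
  import Data.Sum
  open import Data.Vec using (Vec; []; _∷_; toList; here; there)
  import Data.Vec as V
  open import Data.Vec.Relation.Unary.All using () renaming (All to VAll)
  open import Data.Vec.Relation.Unary.All.Properties using (lookup⁺)
  open import Data.Vec.Properties using (length-toList)
  open import Data.Unit using () renaming (⊤ to Unit)
  open import Function using (_∘_; flip; id)
  open import Function.Bundles using (_⇔_; mk⇔; Equivalence)
  import Function.Properties.Equivalence as ⇔
  open import Relation.Binary.PropositionalEquality
    using (_≡_; _≢_; refl; sym; trans; cong; cong₂; subst; subst₂; module ≡-Reasoning)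
  open import Relation.Nullary using (¬_; yes; no)

  private
    variable
      A : Set
      k : ℕ

  drop-suc : ∀ (xs : List A) k {z zs} → drop k xs ≡ z ∷ zs → drop (suc k) xs ≡ zs
  drop-suc (x ∷ xs) zero refl = refl
  drop-suc (x ∷ xs) (suc k) eq = drop-suc xs k eq

  drop≡∷⇒lookup : ∀ (xs : List A) k {z zs} → drop k xs ≡ z ∷ zs →
    Σ (Fin (length xs)) λ i → toℕ i ≡ k × lookup xs i ≡ z
  drop≡∷⇒lookup (x ∷ xs) zero refl = zero , refl , refl
  drop≡∷⇒lookup (x ∷ xs) (suc k) eq with drop≡∷⇒lookup xs k eq
  ... | i , refl , eq′ = suc i , refl , eq′

  drop-lookup : ∀ (xs : List A) (i : Fin (length xs)) → drop (toℕ i) xs ≡ lookup xs i ∷ drop (suc (toℕ i)) xs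
  drop-lookup (x ∷ xs) zero = refl
  drop-lookup (x ∷ xs) (suc i) = drop-lookup xs i

  drop-tabulate : ∀ {n} (f : Fin n → A) (i : Fin n) →
    drop (toℕ i) (tabulate f) ≡ f i ∷ drop (suc (toℕ i)) (tabulate f)
  drop-tabulate f zero = refl
  drop-tabulate f (suc i) = drop-tabulate (f ∘ suc) i

  All-swap : ∀ {P : A → Set} pre a b post → All P (pre ++ a ∷ b ∷ post) → All P (pre ++ b ∷ a ∷ post)
  All-swap [] a b post (pa ∷ pb ∷ ps) = pb ∷ pa ∷ ps
  All-swap (e ∷ pre) a b post (pe ∷ ps) = pe ∷ All-swap pre a b post ps

  All-merge : ∀ {P : A → Set} (_∙_ : A → A → A) → (∀ {a b} → P a → P b → P (a ∙ b)) →
    ∀ pre a b post → All P (pre ++ a ∷ b ∷ post) → All P (pre ++ (a ∙ b) ∷ post)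
  All-merge _∙_ P∙ [] a b post (pa ∷ pb ∷ ps) = P∙ pa pb ∷ ps
  All-merge _∙_ P∙ (e ∷ pre) a b post (pe ∷ ps) = pe ∷ All-merge _∙_ P∙ pre a b post ps

  length-merge : ∀ (P N : List A) a b c R → length (P ++ N ++ a ∷ b ∷ R) ≡ suc (length (P ++ N ++ c ∷ R))
  length-merge [] [] a b c R = refl
  length-merge [] (x ∷ N) a b c R = cong suc (length-merge [] N a b c R)
  length-merge (x ∷ P) N a b c R = cong suc (length-merge P N a b c R)

  drop≡[]⇒length≤ : ∀ (xs : List A) k → drop k xs ≡ [] → length xs ≤ k
  drop≡[]⇒length≤ [] k _ = z≤n
  drop≡[]⇒length≤ (x ∷ xs) (suc k) eq = s≤s (drop≡[]⇒length≤ xs k eq)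

  All-reverse : ∀ {P : A → Set} {xs} → All P xs → All P (reverse xs)
  All-reverse [] = []
  All-reverse {xs = x ∷ xs} (px ∷ pxs) =
    subst (All _) (sym (unfold-reverse x xs)) (++⁺ (All-reverse pxs) (px ∷ []))

  down-induction : ∀ {n} (P : ℕ → Set) → (∀ b → n ≤ b → P b) →
    (∀ (j : Fin n) → P (suc (toℕ j)) → P (toℕ j)) → ∀ b → P b
  down-induction {n} P base step b = go′ n b (m≤m+n n b)
    where
    go′ : ∀ c b → n ≤ c + b → P b
    go′ zero b n≤b = base b n≤b
    go′ (suc c) b n≤c+b with n ≤? b
    ... | yes n≤b = base b n≤b
    ... | no n≰b = subst P (toℕ-fromℕ< b<n)
           (step (fromℕ< b<n) (subst (P ∘ suc) (sym (toℕ-fromℕ< b<n))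
             (go′ c (suc b) (subst (n ≤_) (sym (+-suc c b)) n≤c+b))))
      where
      b<n : b < n
      b<n = ≰⇒> n≰b

  drop-toList : ∀ (v : Vec A k) a {x xs} → drop a (toList v) ≡ x ∷ xs →
    Σ (Fin k) λ i → toℕ i ≡ a × V.lookup v i ≡ x
  drop-toList (y ∷ v) zero refl = zero , refl , refl
  drop-toList (y ∷ v) (suc a) eq with drop-toList v a eq
  ... | i , refl , eq′ = suc i , refl , eq′

  +≡+⇒<⇔> : ∀ {a x c y} → a + x ≡ c + y → x < y ⇔ c < a
  +≡+⇒<⇔> {a} {x} {c} {y} eq = mk⇔
    (λ x<y → +-cancelʳ-< y c a (subst (_< a + y) eq (+-monoʳ-< a x<y)))
    (λ c<a → +-cancelˡ-< a x y (subst (_< a + y) (sym eq) (+-monoˡ-< y c<a)))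

  Disjoint : Subset k → Subset k → Set
  Disjoint p q = ∀ {x} → x ∈ p → x ∉ q

  ∪-lub : ∀ {p q r : Subset k} → p ⊆ r → q ⊆ r → p ∪ q ⊆ r
  ∪-lub {p = p} {q} p⊆r q⊆r x∈p∪q = [ p⊆r , q⊆r ] (x∈p∪q⁻ p q x∈p∪q)

  Disjoint-∪ : ∀ {p q r : Subset k} → Disjoint p r → Disjoint q r → Disjoint (p ∪ q) r
  Disjoint-∪ {p = p} {q} p#r q#r x∈p∪q = [ p#r , q#r ] (x∈p∪q⁻ p q x∈p∪q)

  ∈⇒≢⊥ : ∀ {x} {p : Subset k} → x ∈ p → p ≢ ⊥
  ∈⇒≢⊥ x∈p refl = ∉⊥ x∈p

  ∉⇒≢⊤ : ∀ {x} {p : Subset k} → x ∉ p → p ≢ ⊤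
  ∉⇒≢⊤ x∉p refl = x∉p ∈⊤

  lower : ℕ → Subset k
  lower zero = ⊥
  lower {zero} (suc a) = []
  lower {suc k} (suc a) = inside ∷ lower a

  ∈lower-suc : (i : Fin k) → i ∈ lower (suc (toℕ i))
  ∈lower-suc zero = here
  ∈lower-suc (suc i) = there (∈lower-suc i)

  lower∪⁅⁆ : (i : Fin k) → lower (toℕ i) ∪ ⁅ i ⁆ ≡ lower (suc (toℕ i))
  lower∪⁅⁆ zero = cong (inside ∷_) (∪-identityˡ ⊥)
  lower∪⁅⁆ (suc i) = cong (inside ∷_) (lower∪⁅⁆ i)

  ⁅⁆∪∁lower : (i : Fin k) → ⁅ i ⁆ ∪ ∁ (lower (suc (toℕ i))) ≡ ∁ (lower (toℕ i))
  ⁅⁆∪∁lower zero = cong (inside ∷_) (∪-identityˡ _)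
  ⁅⁆∪∁lower (suc i) = cong (outside ∷_) (⁅⁆∪∁lower i)

  lower∪∁lower-suc : (i : Fin k) → lower (toℕ i) ∪ ∁ (lower (suc (toℕ i))) ≡ ∁ ⁅ i ⁆
  lower∪∁lower-suc zero = cong (outside ∷_) (∪-identityˡ _)
  lower∪∁lower-suc (suc i) = cong (inside ∷_) (lower∪∁lower-suc i)

  lower-nonempty : ∀ {a} → 1 ≤ k → 1 ≤ a → Nonempty (lower {k} a)
  lower-nonempty {suc k} {suc a} _ _ = zero , here

  ⁅⁆#∁lower-suc : (i : Fin k) → Disjoint ⁅ i ⁆ (∁ (lower (suc (toℕ i))))
  ⁅⁆#∁lower-suc i x∈⁅i⁆ rewrite x∈⁅y⁆⇒x≡y i x∈⁅i⁆ = x∈p⇒x∉∁p (∈lower-suc i)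

  ⁅⁆≢⊤ : (i : Fin k) → 1 ≤ toℕ i → ⁅ i ⁆ ≢ ⊤
  ⁅⁆≢⊤ (suc i) _ ()

  ∁lower-≥ : ∀ {b} → k ≤ b → ∁ (lower {k} b) ≡ ⊥
  ∁lower-≥ {zero} {zero} _ = refl
  ∁lower-≥ {zero} {suc b} _ = refl
  ∁lower-≥ {suc k} (s≤s k≤b) = cong (outside ∷_) (∁lower-≥ k≤b)

  wt-⊥ : (v : Vec ℕ k) → wt v ⊥ ≡ 0
  wt-⊥ [] = refl
  wt-⊥ (x ∷ v) = wt-⊥ v

  wt-⊤ : (v : Vec ℕ k) → wt v ⊤ ≡ V.sum v
  wt-⊤ [] = refl
  wt-⊤ (x ∷ v) = cong (x +_) (wt-⊤ v)

  wt-mono : (v : Vec ℕ k) {p q : Subset k} → p ⊆ q → wt v p ≤ wt v q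
  wt-mono [] {[]} {[]} _ = z≤n
  wt-mono (x ∷ v) {outside ∷ p} {_ ∷ q} p⊆q = ≤-trans (wt-mono v (drop-∷-⊆ p⊆q)) (m≤n+m _ _)
  wt-mono (x ∷ v) {inside ∷ p} {_ ∷ q} p⊆q with p⊆q here
  ... | here = +-monoʳ-≤ x (wt-mono v (drop-∷-⊆ p⊆q))

  wt-∪ : (v : Vec ℕ k) {p q : Subset k} → Disjoint p q → wt v (p ∪ q) ≡ wt v p + wt v q
  wt-∪ [] {[]} {[]} _ = refl
  wt-∪ (x ∷ v) {outside ∷ p} {outside ∷ q} p#q = wt-∪ v (λ x∈p x∈q → p#q (there x∈p) (there x∈q))
  wt-∪ (x ∷ v) {outside ∷ p} {inside ∷ q} p#q =
    trans (cong (x +_) (wt-∪ v (λ x∈p x∈q → p#q (there x∈p) (there x∈q))))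
      (x+[y+z]≡y+[x+z] x (wt v p) (wt v q))
    where
    x+[y+z]≡y+[x+z] : ∀ x y z → x + (y + z) ≡ y + (x + z)
    x+[y+z]≡y+[x+z] x y z = trans (sym (+-assoc x y z)) (trans (cong (_+ z) (+-comm x y)) (+-assoc y x z))
  wt-∪ (x ∷ v) {inside ∷ p} {outside ∷ q} p#q =
    trans (cong (x +_) (wt-∪ v (λ x∈p x∈q → p#q (there x∈p) (there x∈q)))) (sym (+-assoc x _ _))
  wt-∪ (x ∷ v) {inside ∷ p} {inside ∷ q} p#q = ⊥-elim (p#q here here)

  wt-∪∁ : (v : Vec ℕ k) (p : Subset k) → wt v p + wt v (∁ p) ≡ V.sum v
  wt-∪∁ [] [] = refl
  wt-∪∁ (x ∷ v) (inside ∷ p) = trans (+-assoc x _ _) (cong (x +_) (wt-∪∁ v p))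
  wt-∪∁ (x ∷ v) (outside ∷ p) =
    trans (sym (+-assoc (wt v p) x _)) (trans (cong (_+ wt v (∁ p)) (+-comm (wt v p) x))
      (trans (+-assoc x _ _) (cong (x +_) (wt-∪∁ v p))))

  wt-⁅⁆ : (v : Vec ℕ k) (i : Fin k) → wt v ⁅ i ⁆ ≡ V.lookup v i
  wt-⁅⁆ (x ∷ v) zero = trans (cong (x +_) (wt-⊥ v)) (+-identityʳ x)
  wt-⁅⁆ (x ∷ v) (suc i) = wt-⁅⁆ v i

  wt-∁lower : (v : Vec ℕ k) (a : ℕ) → wt v (∁ (lower a)) ≡ sum (drop a (toList v))
  wt-∁lower [] zero = refl
  wt-∁lower [] (suc a) = refl
  wt-∁lower (x ∷ v) zero = cong (x +_) (wt-∁lower v zero)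
  wt-∁lower (x ∷ v) (suc a) = wt-∁lower v a

  wt-lower+drop : (v : Vec ℕ k) (a : ℕ) → wt v (lower a) + sum (drop a (toList v)) ≡ V.sum v
  wt-lower+drop v a = trans (cong (wt v (lower a) +_) (sym (wt-∁lower v a))) (wt-∪∁ v (lower a))

  wt-lower-suc : (v : Vec ℕ k) (a : ℕ) {x : ℕ} {xs : List ℕ} → drop a (toList v) ≡ x ∷ xs →
    wt v (lower (suc a)) ≡ wt v (lower a) + x
  wt-lower-suc (y ∷ v) zero refl = +-comm y (wt v ⊥)
  wt-lower-suc (y ∷ v) (suc a) eq = trans (cong (y +_) (wt-lower-suc v a eq)) (sym (+-assoc y _ _))

  -- The ordering φ

  if-elim : ∀ (P : A → Set) c {x y} → P x → P y → P (if c then x else y)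
  if-elim P true px py = px
  if-elim P false px py = py

  oppSum-go-ν : ∀ xs ys sa sb → oppSum νside (go xs ys sa sb) ≡ sum xs
  oppSum-go-ν [] [] sa sb = refl
  oppSum-go-ν [] (y ∷ ys) sa sb = oppSum-go-ν [] ys sa (sb + y)
  oppSum-go-ν (x ∷ xs) [] sa sb = cong (x +_) (oppSum-go-ν xs [] (sa + x) sb)
  oppSum-go-ν (x ∷ xs) (y ∷ ys) sa sb = if-elim (λ w → oppSum νside w ≡ x + sum xs) (sb <ᵇ sa)
    (oppSum-go-ν (x ∷ xs) ys sa (sb + y)) (cong (x +_) (oppSum-go-ν xs (y ∷ ys) (sa + x) sb))

  oppSum-go-μ : ∀ xs ys sa sb → oppSum μside (go xs ys sa sb) ≡ sum ys
  oppSum-go-μ [] [] sa sb = refl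
  oppSum-go-μ [] (y ∷ ys) sa sb = cong (y +_) (oppSum-go-μ [] ys sa (sb + y))
  oppSum-go-μ (x ∷ xs) [] sa sb = oppSum-go-μ xs [] (sa + x) sb
  oppSum-go-μ (x ∷ xs) (y ∷ ys) sa sb = if-elim (λ w → oppSum μside w ≡ y + sum ys) (sb <ᵇ sa)
    (cong (y +_) (oppSum-go-μ (x ∷ xs) ys sa (sb + y))) (oppSum-go-μ xs (y ∷ ys) (sa + x) sb)

  go-ν : ∀ {x xs y ys sa sb} → (sb <ᵇ sa) ≡ true →
    go (x ∷ xs) (y ∷ ys) sa sb ≡ (νside , y) ∷ go (x ∷ xs) ys sa (sb + y)
  go-ν eq rewrite eq = refl

  go-μ : ∀ {x xs y ys sa sb} → (sb <ᵇ sa) ≡ false →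
    go (x ∷ xs) (y ∷ ys) sa sb ≡ (μside , x) ∷ go xs (y ∷ ys) (sa + x) sb
  go-μ eq rewrite eq = refl

  -- The condition on φ at list position k, i.e. at φ(k+1).
  PhiAt : ∀ {m n} → Vec ℕ m → Vec ℕ n → ℕ → Set
  PhiAt μ ν k = ∀ {z zs} → drop k (φ μ ν) ≡ z ∷ zs → oppSum (proj₁ z) zs < proj₂ z

  PhiAt-∷ : ∀ {m n} (μ : Vec ℕ m) (ν : Vec ℕ n) k {z zs} → drop k (φ μ ν) ≡ z ∷ zs →
    PhiAt μ ν k ⇔ oppSum (proj₁ z) zs < proj₂ z
  PhiAt-∷ μ ν k {z} {zs} eq = mk⇔ (λ h → h eq) from
    where
    from : oppSum (proj₁ z) zs < proj₂ z → PhiAt μ ν k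
    from lt eq′ with refl , refl ← ∷-injective (trans (sym eq) eq′) = lt

  PhiAt-ν : ∀ {m n} (μ : Vec ℕ m) (ν : Vec ℕ n) k {y} xs ys sa sb →
    drop k (φ μ ν) ≡ (νside , y) ∷ go xs ys sa sb → PhiAt μ ν k ⇔ sum xs < y
  PhiAt-ν μ ν k {y} xs ys sa sb eq =
    subst (λ s → PhiAt μ ν k ⇔ s < y) (oppSum-go-ν xs ys sa sb) (PhiAt-∷ μ ν k eq)

  PhiAt-μ : ∀ {m n} (μ : Vec ℕ m) (ν : Vec ℕ n) k {x} xs ys sa sb →
    drop k (φ μ ν) ≡ (μside , x) ∷ go xs ys sa sb → PhiAt μ ν k ⇔ sum ys < x
  PhiAt-μ μ ν k {x} xs ys sa sb eq =
    subst (λ s → PhiAt μ ν k ⇔ s < x) (oppSum-go-μ xs ys sa sb) (PhiAt-∷ μ ν k eq)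

  PhiAt-[] : ∀ {m n} (μ : Vec ℕ m) (ν : Vec ℕ n) {k} → length (φ μ ν) ≤ k → PhiAt μ ν k
  PhiAt-[] μ ν {k} len≤k eq with () ← trans (sym (drop-all k (φ μ ν) len≤k)) eq

  PhiCondition⇔PhiAt : ∀ {m n} (μ : Vec ℕ m) (ν : Vec ℕ n) →
    PhiCondition μ ν ⇔ (∀ k → 1 ≤ k → PhiAt μ ν k)
  PhiCondition⇔PhiAt μ ν = mk⇔ to from
    where
    to : PhiCondition μ ν → ∀ k → 1 ≤ k → PhiAt μ ν k
    to pc k 1≤k {z} {zs} eq with drop≡∷⇒lookup (φ μ ν) k eq
    ... | i , refl , refl = subst (λ zs → oppSum (proj₁ z) zs < proj₂ z)
                              (proj₂ (∷-injective (trans (sym (drop-lookup (φ μ ν) i)) eq))) (pc i 1≤k)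
    from : (∀ k → 1 ≤ k → PhiAt μ ν k) → PhiCondition μ ν
    from h i 1≤i = h (toℕ i) 1≤i (drop-lookup (φ μ ν) i)

  -- Moves on words

  module Moves {m n : ℕ} (μ : Vec ℕ m) (ν : Vec ℕ n) where
    open Words μ ν public

    NonPos : Entry → Set
    NonPos e = ¬ Pos e

    Neg : Entry → Set
    Neg (I , J) = wt μ I < wt ν J

    Unique : Word → Set
    Unique w = ∀ {q q′} → Reaches w q → Reaches w q′ → q ≡ q′

    ++-∷≢[] : ∀ (pre : Word) x post → pre ++ x ∷ post ≢ []
    ++-∷≢[] [] x post ()
    ++-∷≢[] (_ ∷ _) x post ()

    ++-∷-∷≢[-] : ∀ pre a b post {x} → pre ++ a ∷ b ∷ post ≢ x ∷ []
    ++-∷-∷≢[-] [] a b post ()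
    ++-∷-∷≢[-] (e ∷ pre) a b post eq = ++-∷≢[] pre a (b ∷ post) (proj₂ (∷-injective eq))

    lastPos-unique : ∀ pre a b post pre′ a′ b′ post′ →
      Pos a → All NonPos (b ∷ post) → Pos a′ → All NonPos (b′ ∷ post′) →
      pre ++ a ∷ b ∷ post ≡ pre′ ++ a′ ∷ b′ ∷ post′ →
      pre ≡ pre′ × a ≡ a′ × b ≡ b′ × post ≡ post′
    lastPos-unique [] a b post [] a′ b′ post′ _ _ _ _ refl = refl , refl , refl , refl
    lastPos-unique [] a b post (e ∷ pre′) a′ b′ post′ _ np pa′ _ eq
      = ⊥-elim (All.head (++⁻ʳ pre′ (subst (All NonPos) (proj₂ (∷-injective eq)) np)) pa′)
    lastPos-unique (e ∷ pre) a b post [] a′ b′ post′ pa _ _ np′ eq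
      = ⊥-elim (All.head (++⁻ʳ pre (subst (All NonPos) (sym (proj₂ (∷-injective eq))) np′)) pa)
    lastPos-unique (e ∷ pre) a b post (e′ ∷ pre′) a′ b′ post′ pa np pa′ np′ eq
      with refl , eq′ ← ∷-injective eq
      with refl , refl , refl , refl ← lastPos-unique pre a b post pre′ a′ b′ post′ pa np pa′ np′ eq′
      = refl , refl , refl , refl

    Reaches-[-] : ∀ {x q} → Reaches (x ∷ []) q → q ≡ []
    Reaches-[-] r = inv r refl
      where
      inv : ∀ {w x q} → Reaches w q → w ≡ x ∷ [] → q ≡ []
      inv (success _) _ = refl
      inv (passing pre a b post _ _ _) eq = ⊥-elim (++-∷-∷≢[-] pre a b post eq)
      inv (canceling pre a b post _ _ _) eq = ⊥-elim (++-∷-∷≢[-] pre a b post eq)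

    Reaches-inv : ∀ pre a b post {q} → Pos a → All NonPos (b ∷ post) →
      Reaches (pre ++ a ∷ b ∷ post) q →
      Reaches (pre ++ b ∷ a ∷ post) q
        ⊎ Σ (List Quad) λ q′ → q ≡ (a , b) ∷ q′ × Reaches (pre ++ (a ∪ₑ b) ∷ post) q′
    Reaches-inv pre a b post pa np r = inv r refl
      where
      inv : ∀ {w q} → Reaches w q → w ≡ pre ++ a ∷ b ∷ post →
        Reaches (pre ++ b ∷ a ∷ post) q
          ⊎ Σ (List Quad) λ q′ → q ≡ (a , b) ∷ q′ × Reaches (pre ++ (a ∪ₑ b) ∷ post) q′
      inv (success _) eq = ⊥-elim (++-∷-∷≢[-] pre a b post (sym eq))
      inv (passing pre′ a′ b′ post′ pa′ np′ r′) eq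
        with refl , refl , refl , refl ← lastPos-unique pre′ a′ b′ post′ pre a b post pa′ np′ pa np eq
        = inj₁ r′
      inv (canceling pre′ a′ b′ post′ pa′ np′ r′) eq
        with refl , refl , refl , refl ← lastPos-unique pre′ a′ b′ post′ pre a b post pa′ np′ pa np eq
        = inj₂ (_ , refl , r′)

    Unique-cancel : ∀ pre a b post → Pos a → All NonPos (b ∷ post) →
      (∀ {q} → ¬ Reaches (pre ++ b ∷ a ∷ post) q) →
      Unique (pre ++ (a ∪ₑ b) ∷ post) → Unique (pre ++ a ∷ b ∷ post)
    Unique-cancel pre a b post pa np dead u r r′
      with Reaches-inv pre a b post pa np r | Reaches-inv pre a b post pa np r′
    ... | inj₁ p | _ = ⊥-elim (dead p)
    ... | inj₂ _ | inj₁ p = ⊥-elim (dead p)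
    ... | inj₂ (_ , refl , c) | inj₂ (_ , refl , c′) = cong ((a , b) ∷_) (u c c′)

    Unique-merge : ∀ pre a b post → Pos a → All NonPos (b ∷ post) →
      Unique (pre ++ a ∷ b ∷ post) → Unique (pre ++ (a ∪ₑ b) ∷ post)
    Unique-merge pre a b post pa np u c c′ =
      proj₂ (∷-injective (u (canceling pre a b post pa np c) (canceling pre a b post pa np c′)))

    Unique-passing : ∀ pre a b post {q q′ r} → Pos a → All NonPos (b ∷ post) →
      Unique (pre ++ a ∷ b ∷ post) → Reaches (pre ++ (a ∪ₑ b) ∷ post) q →
      Reaches (pre ++ b ∷ a ∷ post) ((a , r) ∷ q′) → r ≡ b
    Unique-passing pre a b post pa np u c p =
      proj₂ (,-injective (proj₁ (∷-injective (u (passing pre a b post pa np p) (canceling pre a b post pa np c)))))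

    -- A word is dead once some entry other than the first keeps e > 0 whatever it absorbs from
    -- its right: such an entry can never merge with its left neighbour.
    module DoomedWords (H : Subset n) (S : Subset m) (H<S : wt ν H < wt μ S) where

      Forced : Entry → Set
      Forced (I , J) = S ⊆ I × J ⊆ H

      Bounded : Entry → Set
      Bounded (_ , J) = J ⊆ H

      Forced⇒Pos : ∀ {e} → Forced e → Pos e
      Forced⇒Pos (S⊆I , J⊆H) = ≤-<-trans (wt-mono ν J⊆H) (<-≤-trans H<S (wt-mono μ S⊆I))

      data Trapped : Word → Set where
        here : ∀ {y w} → Forced y → All Bounded w → Trapped (y ∷ w)
        there : ∀ {e w} → Trapped w → Trapped (e ∷ w)

      Doomed : Word → Set
      Doomed [] = Empty
      Doomed (_ ∷ w) = Trapped w

      Trapped⇒¬NonPos : ∀ {w} → Trapped w → ¬ All NonPos w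
      Trapped⇒¬NonPos (here fy _) (np ∷ _) = np (Forced⇒Pos fy)
      Trapped⇒¬NonPos (there t) (_ ∷ nps) = Trapped⇒¬NonPos t nps

      Trapped-moves : ∀ pre a b post → All NonPos (b ∷ post) → Trapped (pre ++ a ∷ b ∷ post) →
        Trapped (pre ++ b ∷ a ∷ post) × Trapped (pre ++ (a ∪ₑ b) ∷ post)
      Trapped-moves [] a b post np (here (S⊆I , J⊆H) (bb ∷ bs)) =
        there (here (S⊆I , J⊆H) bs) , here (⊆-trans S⊆I (p⊆p∪q _) , ∪-lub J⊆H bb) bs
      Trapped-moves [] a b post np (there t) = ⊥-elim (Trapped⇒¬NonPos t np)
      Trapped-moves (e ∷ pre) a b post np (here fe bs) =
        here fe (All-swap pre a b post bs) ,
        here fe (All-merge _∪ₑ_ (λ {a} {b} → ∪-lub {p = proj₂ a} {q = proj₂ b}) pre a b post bs)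
      Trapped-moves (e ∷ pre) a b post np (there t) =
        Data.Product.map there there (Trapped-moves pre a b post np t)

      Doomed-intro : ∀ pre z y w → Forced y → All Bounded w → Doomed (pre ++ z ∷ y ∷ w)
      Doomed-intro [] z y w fy bw = here fy bw
      Doomed-intro (e ∷ pre) z y w fy bw = trapped pre (there (here fy bw))
        where
        trapped : ∀ pre {w} → Trapped w → Trapped (pre ++ w)
        trapped [] t = t
        trapped (_ ∷ pre) t = there (trapped pre t)

      Doomed-moves : ∀ pre a b post → All NonPos (b ∷ post) → Doomed (pre ++ a ∷ b ∷ post) →
        Doomed (pre ++ b ∷ a ∷ post) × Doomed (pre ++ (a ∪ₑ b) ∷ post)
      Doomed-moves [] a b post np t = ⊥-elim (Trapped⇒¬NonPos t np)
      Doomed-moves (e ∷ pre) a b post np t = Trapped-moves pre a b post np t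

      Doomed⇒¬Reaches : ∀ {w q} → Doomed w → ¬ Reaches w q
      Doomed⇒¬Reaches () (success _)
      Doomed⇒¬Reaches d (passing pre a b post _ np r) =
        Doomed⇒¬Reaches (proj₁ (Doomed-moves pre a b post np d)) r
      Doomed⇒¬Reaches d (canceling pre a b post _ np r) =
        Doomed⇒¬Reaches (proj₂ (Doomed-moves pre a b post np d)) r


    cov : Word → Entry
    cov [] = (⊥ , ⊥)
    cov (e ∷ w) = e ∪ₑ cov w

    _⊆ₑ_ : Entry → Entry → Set
    (I , J) ⊆ₑ (K , L) = I ⊆ K × J ⊆ L

    _#_ : Entry → Entry → Set
    (I , J) # (K , L) = Disjoint I K × Disjoint J L

    PairwiseDisjoint : Word → Set
    PairwiseDisjoint [] = Unit
    PairwiseDisjoint (e ∷ w) = e # cov w × PairwiseDisjoint w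

    Occupied : Entry → Set
    Occupied (I , J) = Nonempty I ⊎ Nonempty J

    Partition : Word → Set
    Partition w = PairwiseDisjoint w × cov w ≡ (⊤ , ⊤) × All Occupied w

    ∪ₑ-assoc : ∀ a b c → (a ∪ₑ b) ∪ₑ c ≡ a ∪ₑ (b ∪ₑ c)
    ∪ₑ-assoc a b c = cong₂ _,_ (∪-assoc (proj₁ a) _ _) (∪-assoc (proj₂ a) _ _)

    ∪ₑ-comm : ∀ a b → a ∪ₑ b ≡ b ∪ₑ a
    ∪ₑ-comm a b = cong₂ _,_ (∪-comm (proj₁ a) _) (∪-comm (proj₂ a) _)

    ⊆ₑ-∪ˡ : ∀ a b → a ⊆ₑ (a ∪ₑ b)
    ⊆ₑ-∪ˡ a b = p⊆p∪q (proj₁ b) , p⊆p∪q (proj₂ b)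

    ⊆ₑ-∪ʳ : ∀ a b → b ⊆ₑ (a ∪ₑ b)
    ⊆ₑ-∪ʳ a b = q⊆p∪q (proj₁ a) _ , q⊆p∪q (proj₂ a) _

    #-sym : ∀ {a b} → a # b → b # a
    #-sym (I#K , J#L) = (λ x∈K x∈I → I#K x∈I x∈K) , (λ x∈L x∈J → J#L x∈J x∈L)

    #-⊆ʳ : ∀ {a b c} → a # b → c ⊆ₑ b → a # c
    #-⊆ʳ (I#K , J#L) (M⊆K , N⊆L) = (λ x∈I → I#K x∈I ∘ M⊆K) , (λ x∈J → J#L x∈J ∘ N⊆L)

    #-⊆ˡ : ∀ {a b c} → a # c → b ⊆ₑ a → b # c
    #-⊆ˡ a#c b⊆a = #-sym (#-⊆ʳ (#-sym a#c) b⊆a)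

    #-∪ˡ : ∀ {a b c} → a # c → b # c → (a ∪ₑ b) # c
    #-∪ˡ (I#M , J#N) (K#M , L#N) = Disjoint-∪ I#M K#M , Disjoint-∪ J#N L#N

    #-∪ʳ : ∀ {a b c} → a # b → a # c → a # (b ∪ₑ c)
    #-∪ʳ a#b a#c = #-sym (#-∪ˡ (#-sym a#b) (#-sym a#c))

    cov-congˡ : ∀ pre {u v} → cov u ≡ cov v → cov (pre ++ u) ≡ cov (pre ++ v)
    cov-congˡ [] eq = eq
    cov-congˡ (e ∷ pre) eq = cong (e ∪ₑ_) (cov-congˡ pre eq)

    cov-swap : ∀ pre a b post → cov (pre ++ a ∷ b ∷ post) ≡ cov (pre ++ b ∷ a ∷ post)
    cov-swap pre a b post = cov-congˡ pre (begin
      a ∪ₑ (b ∪ₑ cov post)  ≡⟨ ∪ₑ-assoc a b _ ⟨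
      (a ∪ₑ b) ∪ₑ cov post  ≡⟨ cong (_∪ₑ cov post) (∪ₑ-comm a b) ⟩
      (b ∪ₑ a) ∪ₑ cov post  ≡⟨ ∪ₑ-assoc b a _ ⟩
      b ∪ₑ (a ∪ₑ cov post)  ∎)
      where open ≡-Reasoning

    cov-merge : ∀ pre a b post → cov (pre ++ a ∷ b ∷ post) ≡ cov (pre ++ (a ∪ₑ b) ∷ post)
    cov-merge pre a b post = cov-congˡ pre (sym (∪ₑ-assoc a b (cov post)))

    PairwiseDisjoint-swap : ∀ pre a b post →
      PairwiseDisjoint (pre ++ a ∷ b ∷ post) → PairwiseDisjoint (pre ++ b ∷ a ∷ post)
    PairwiseDisjoint-swap [] a b post (a#b∪post , b#post , d) =
      #-∪ʳ (#-sym (#-⊆ʳ a#b∪post (⊆ₑ-∪ˡ b _))) b#post , #-⊆ʳ a#b∪post (⊆ₑ-∪ʳ b _) , d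
    PairwiseDisjoint-swap (e ∷ pre) a b post (e#rest , d) =
      subst (e #_) (cov-swap pre a b post) e#rest , PairwiseDisjoint-swap pre a b post d

    PairwiseDisjoint-merge : ∀ pre a b post →
      PairwiseDisjoint (pre ++ a ∷ b ∷ post) → PairwiseDisjoint (pre ++ (a ∪ₑ b) ∷ post)
    PairwiseDisjoint-merge [] a b post (a#b∪post , b#post , d) =
      #-∪ˡ (#-⊆ʳ a#b∪post (⊆ₑ-∪ʳ b _)) b#post , d
    PairwiseDisjoint-merge (e ∷ pre) a b post (e#rest , d) =
      subst (e #_) (cov-merge pre a b post) e#rest , PairwiseDisjoint-merge pre a b post d

    ⊆ₑ-trans : ∀ {a b c} → a ⊆ₑ b → b ⊆ₑ c → a ⊆ₑ c
    ⊆ₑ-trans (I⊆K , J⊆L) (K⊆M , L⊆N) = ⊆-trans I⊆K K⊆M , ⊆-trans J⊆L L⊆N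

    All-⊆ₑ-cov : ∀ w → All (_⊆ₑ cov w) w
    All-⊆ₑ-cov [] = []
    All-⊆ₑ-cov (e ∷ w) =
      ⊆ₑ-∪ˡ e (cov w) ∷ All.map (λ s → ⊆ₑ-trans s (⊆ₑ-∪ʳ e (cov w))) (All-⊆ₑ-cov w)

    #-∅ : ∀ {a} → a # (⊥ , ⊥)
    #-∅ = (λ _ → ∉⊥) , (λ _ → ∉⊥)

    cov-++ : ∀ u v → cov (u ++ v) ≡ cov u ∪ₑ cov v
    cov-++ [] v = sym (cong₂ _,_ (∪-identityˡ _) (∪-identityˡ _))
    cov-++ (e ∷ u) v = trans (cong (e ∪ₑ_) (cov-++ u v)) (sym (∪ₑ-assoc e (cov u) (cov v)))

    PairwiseDisjoint-++ : ∀ u v → PairwiseDisjoint u → PairwiseDisjoint v → cov u # cov v →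
      PairwiseDisjoint (u ++ v)
    PairwiseDisjoint-++ [] v _ dv _ = dv
    PairwiseDisjoint-++ (e ∷ u) v (e#u , du) dv e∪u#v =
      subst (e #_) (sym (cov-++ u v)) (#-∪ʳ e#u (#-⊆ˡ e∪u#v (⊆ₑ-∪ˡ e (cov u)))) ,
      PairwiseDisjoint-++ u v du dv (#-⊆ˡ e∪u#v (⊆ₑ-∪ʳ e (cov u)))

    Occupied-∪ : ∀ {a b} → Occupied a → Occupied b → Occupied (a ∪ₑ b)
    Occupied-∪ {a} {b} (inj₁ (x , x∈I)) _ = inj₁ (x , p⊆p∪q (proj₁ b) x∈I)
    Occupied-∪ {a} {b} (inj₂ (x , x∈J)) _ = inj₂ (x , p⊆p∪q (proj₂ b) x∈J)

    Partition-swap : ∀ pre a b post → Partition (pre ++ a ∷ b ∷ post) → Partition (pre ++ b ∷ a ∷ post)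
    Partition-swap pre a b post (d , c , o) =
      PairwiseDisjoint-swap pre a b post d , trans (sym (cov-swap pre a b post)) c , All-swap pre a b post o

    Partition-merge : ∀ pre a b post → Partition (pre ++ a ∷ b ∷ post) → Partition (pre ++ (a ∪ₑ b) ∷ post)
    Partition-merge pre a b post (d , c , o) =
      PairwiseDisjoint-merge pre a b post d , trans (sym (cov-merge pre a b post)) c ,
      All-merge _∪ₑ_ (λ {a} {b} → Occupied-∪ {a} {b}) pre a b post o

    wtμ-cov : ∀ e w → e # cov w → wt μ (proj₁ (cov (e ∷ w))) ≡ wt μ (proj₁ e) + wt μ (proj₁ (cov w))
    wtμ-cov e w (I# , _) = wt-∪ μ I#

    wtν-cov : ∀ e w → e # cov w → wt ν (proj₂ (cov (e ∷ w))) ≡ wt ν (proj₂ e) + wt ν (proj₂ (cov w))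
    wtν-cov e w (_ , J#) = wt-∪ ν J#

    cov-AllPos : ∀ w → PairwiseDisjoint w → All Pos w → wt ν (proj₂ (cov w)) ≤ wt μ (proj₁ (cov w))
    cov-AllPos [] _ _ rewrite wt-⊥ ν = z≤n
    cov-AllPos (e ∷ w) (e# , d) (pe ∷ ps) rewrite wtμ-cov e w e# | wtν-cov e w e# =
      +-mono-≤ (<⇒≤ pe) (cov-AllPos w d ps)

    cov-AllNonPos : ∀ w → PairwiseDisjoint w → All NonPos w → wt μ (proj₁ (cov w)) ≤ wt ν (proj₂ (cov w))
    cov-AllNonPos [] _ _ rewrite wt-⊥ μ = z≤n
    cov-AllNonPos (e ∷ w) (e# , d) (ne ∷ ns) rewrite wtμ-cov e w e# | wtν-cov e w e# =
      +-mono-≤ (≮⇒≥ ne) (cov-AllNonPos w d ns)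

    Cancels : Entry → Word → Word → Set
    Cancels c R w =
      Σ Entry λ r → Σ Word λ R′ → R ≡ r ∷ R′ × Σ (List Quad) λ q → Reaches w ((c , r) ∷ q)

    Reachable : Word → Set
    Reachable w = Σ (List Quad) (Reaches w)

    Cancels⇒Reachable : ∀ {c R w} → Cancels c R w → Reachable w
    Cancels⇒Reachable (_ , _ , _ , q , reach) = _ , reach

    module Reachability (Σμ≡Σν : V.sum μ ≡ V.sum ν) (chamber : Chamber μ ν) where

      cov-balanced : ∀ w → cov w ≡ (⊤ , ⊤) → wt μ (proj₁ (cov w)) ≡ wt ν (proj₂ (cov w))
      cov-balanced w eq rewrite eq = trans (wt-⊤ μ) (trans Σμ≡Σν (sym (wt-⊤ ν)))

      Partition-AllPos : ∀ {w} → Partition w → All Pos w → w ≡ []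
      Partition-AllPos {[]} _ _ = refl
      Partition-AllPos {e ∷ w} ((e# , d) , c , _) (pe ∷ ps) = ⊥-elim (<-irrefl (sym (cov-balanced (e ∷ w) c))
        (subst₂ _<_ (sym (wtν-cov e w e#)) (sym (wtμ-cov e w e#)) (+-mono-<-≤ pe (cov-AllPos w d ps))))

      -- The chamber assumption forbids e(x) = 0 for an entry x of a partition with two or more blocks.
      Partition-AllNonPos : ∀ {x y w} → Partition (x ∷ y ∷ w) → ¬ All NonPos (x ∷ y ∷ w)
      Partition-AllNonPos {x} {y} {w} ((x# , d) , c , ox ∷ oy ∷ _) (nx ∷ ns) =
        chamber (proj₁ x) (proj₂ x) x≢∅ x≢full x-balanced
        where
        x-balanced : wt μ (proj₁ x) ≡ wt ν (proj₂ x)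
        x-balanced with m≤n⇒m<n∨m≡n (≮⇒≥ nx)
        ... | inj₂ eq = eq
        ... | inj₁ lt = ⊥-elim (<-irrefl (cov-balanced (x ∷ y ∷ w) c)
          (subst₂ _<_ (sym (wtμ-cov x (y ∷ w) x#)) (sym (wtν-cov x (y ∷ w) x#))
            (+-mono-<-≤ lt (cov-AllNonPos (y ∷ w) d ns))))
        x≢∅ : ¬ (proj₁ x ≡ ⊥ × proj₂ x ≡ ⊥)
        x≢∅ (refl , refl) = [ (λ (_ , z∈⊥) → ∉⊥ z∈⊥) , (λ (_ , z∈⊥) → ∉⊥ z∈⊥) ] ox
        x≢full : ¬ (proj₁ x ≡ ⊤ × proj₂ x ≡ ⊤)
        x≢full (refl , refl) with #-⊆ʳ x# (⊆ₑ-∪ˡ y (cov w))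
        ... | (I# , J#) = [ (λ (_ , z∈I) → I# ∈⊤ z∈I) , (λ (_ , z∈J) → J# ∈⊤ z∈J) ] oy

      Reachable-AllNonPos : ∀ N c R → Partition (N ++ c ∷ R) → All NonPos (N ++ c ∷ R) → Reachable (N ++ c ∷ R)
      Reachable-AllNonPos [] c [] _ _ = [] , success c
      Reachable-AllNonPos [] c (r ∷ R) p np = ⊥-elim (Partition-AllNonPos p np)
      Reachable-AllNonPos (x ∷ []) c R p np = ⊥-elim (Partition-AllNonPos p np)
      Reachable-AllNonPos (x ∷ y ∷ N) c R p np = ⊥-elim (Partition-AllNonPos p np)

      Pos-last-impossible : ∀ P N c → Partition (P ++ N ++ c ∷ []) → All Pos P → Pos c →
        N ≡ [] ⊎ Neg (cov (c ∷ [])) → Empty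
      Pos-last-impossible P N c p pP pc (inj₂ neg)
        rewrite ∪-identityʳ (proj₁ c) | ∪-identityʳ (proj₂ c) = <-asym pc neg
      Pos-last-impossible P .[] c p pP pc (inj₁ refl) =
        ++-∷≢[] P c [] (Partition-AllPos p (++⁺ pP (pc ∷ [])))

      -- In P ++ N ++ c ∷ R the entry c is the last positive one and all of P is positive; N is
      -- empty or e(c ∪ R) < 0, so c cannot absorb all of R and stay positive.  Canceling c with
      -- its neighbour, and falling back on the last entry of P once the merge is no longer
      -- positive, reaches a successful word.
      mutual
        cancels : ∀ fuel P N c R → length (P ++ N ++ c ∷ R) ≤ fuel →
          Partition (P ++ N ++ c ∷ R) → All Pos P → All NonPos N → Pos c → All NonPos R →
          N ≡ [] ⊎ Neg (cov (c ∷ R)) → Cancels c R (P ++ N ++ c ∷ R)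
        cancels fuel P N c [] len p pP nN pc nR cond = ⊥-elim (Pos-last-impossible P N c p pP pc cond)
        cancels zero P N c (r ∷ R) len p pP nN pc nR cond
          = ⊥-elim (n≮0 (subst (_≤ 0) (length-merge P N c r (c ∪ₑ r) R) len))
        cancels (suc fuel) P N c (r ∷ R) len p pP nN pc (nr ∷ nR) cond =
          r , R , refl , proj₁ merged ,
            subst (λ w → Reaches w ((c , r) ∷ proj₁ merged)) (assoc (c ∷ r ∷ R))
              (canceling (P ++ N) c r R pc (nr ∷ nR)
                (subst (λ w → Reaches w (proj₁ merged)) (sym (assoc _)) (proj₂ merged)))
          where
          assoc : ∀ w → (P ++ N) ++ w ≡ P ++ N ++ w
          assoc = ++-assoc P N
          len′ : length (P ++ N ++ (c ∪ₑ r) ∷ R) ≤ fuel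
          len′ = s≤s⁻¹ (subst (_≤ suc fuel) (length-merge P N c r (c ∪ₑ r) R) len)
          p′ : Partition (P ++ N ++ (c ∪ₑ r) ∷ R)
          p′ = subst Partition (assoc _) (Partition-merge (P ++ N) c r R (subst Partition (sym (assoc _)) p))
          cond′ : N ≡ [] ⊎ Neg (cov ((c ∪ₑ r) ∷ R))
          cond′ = Data.Sum.map₂ (subst Neg (cov-merge [] c r R)) cond
          merged : Reachable (P ++ N ++ (c ∪ₑ r) ∷ R)
          merged = reachable fuel P N (c ∪ₑ r) R len′ p′ pP nN nR cond′

        reachable : ∀ fuel P N c R → length (P ++ N ++ c ∷ R) ≤ fuel →
          Partition (P ++ N ++ c ∷ R) → All Pos P → All NonPos N → All NonPos R →
          N ≡ [] ⊎ Neg (cov (c ∷ R)) → Reachable (P ++ N ++ c ∷ R)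
        reachable fuel P N c R len p pP nN nR cond with wt ν (proj₂ c) <? wt μ (proj₁ c)
        ... | yes pc = Cancels⇒Reachable (cancels fuel P N c R len p pP nN pc nR cond)
        ... | no npc with initLast P
        ...   | [] = Reachable-AllNonPos N c R p (++⁺ nN (npc ∷ nR))
        ...   | P₀ ∷ʳ′ x =
          subst Reachable (sym assoc) (Cancels⇒Reachable fallback)
          where
          assoc : (P₀ ∷ʳ x) ++ N ++ c ∷ R ≡ P₀ ++ x ∷ N ++ c ∷ R
          assoc = ++-assoc P₀ (x ∷ []) _
          fallback : Cancels x (N ++ c ∷ R) (P₀ ++ x ∷ N ++ c ∷ R)
          fallback = cancels fuel P₀ [] x (N ++ c ∷ R) (subst (λ w → length w ≤ fuel) assoc len)
            (subst Partition assoc p) (++⁻ˡ P₀ pP) [] (All.head (++⁻ʳ P₀ pP))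
            (++⁺ nN (npc ∷ nR)) (inj₁ refl)

  -- Words along φ

  module Walk {m n : ℕ} (μ : Vec ℕ m) (ν : Vec ℕ n)
    (1≤m : 1 ≤ m) (μ⁺ : VAll (0 <_) μ) (ν⁺ : VAll (0 <_) ν)
    (Σμ≡Σν : V.sum μ ≡ V.sum ν) (chamber : Chamber μ ν) where
    open Moves μ ν
    open Reachability Σμ≡Σν chamber

    μEntry : Fin m → Entry
    μEntry i = (⁅ i ⁆ , ⊥)

    νEntry : Fin n → Entry
    νEntry j = (⊥ , ⁅ j ⁆)

    μRest : ℕ → Word
    μRest a = reverse (drop a (tabulate μEntry))

    νRest : ℕ → Word
    νRest b = drop b (tabulate νEntry)

    block : ℕ → ℕ → Entry
    block a b = (lower a , lower b)

    W : ℕ → ℕ → Word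
    W a b = μRest a ++ block a b ∷ νRest b

    νRest-step : (j : Fin n) → νRest (toℕ j) ≡ νEntry j ∷ νRest (suc (toℕ j))
    νRest-step = drop-tabulate νEntry

    μRest-step : (i : Fin m) → μRest (toℕ i) ≡ μRest (suc (toℕ i)) ++ μEntry i ∷ []
    μRest-step i = trans (cong reverse (drop-tabulate μEntry i))
      (unfold-reverse (μEntry i) (drop (suc (toℕ i)) (tabulate μEntry)))

    νRest-end : ∀ {b} → n ≤ b → νRest b ≡ []
    νRest-end {b} n≤b = drop-all b _ (subst (_≤ b) (sym (length-tabulate νEntry)) n≤b)

    μRest-end : ∀ {a} → m ≤ a → μRest a ≡ []
    μRest-end {a} m≤a = cong reverse (drop-all a _ (subst (_≤ a) (sym (length-tabulate μEntry)) m≤a))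

    W-ν : ∀ a (j : Fin n) → W a (toℕ j) ≡ μRest a ++ block a (toℕ j) ∷ νEntry j ∷ νRest (suc (toℕ j))
    W-ν a j = cong (λ w → μRest a ++ block a (toℕ j) ∷ w) (νRest-step j)

    W-ν-merge : ∀ a (j : Fin n) →
      μRest a ++ (block a (toℕ j) ∪ₑ νEntry j) ∷ νRest (suc (toℕ j)) ≡ W a (suc (toℕ j))
    W-ν-merge a j =
      cong (λ e → μRest a ++ e ∷ νRest (suc (toℕ j))) (cong₂ _,_ (∪-identityʳ _) (lower∪⁅⁆ j))

    W-μ : ∀ (i : Fin m) b → W (toℕ i) b ≡ μRest (suc (toℕ i)) ++ μEntry i ∷ block (toℕ i) b ∷ νRest b
    W-μ i b = trans (cong (_++ block (toℕ i) b ∷ νRest b) (μRest-step i)) (++-assoc (μRest (suc (toℕ i))) _ _)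

    W-μ-merge : ∀ (i : Fin m) b →
      μRest (suc (toℕ i)) ++ (μEntry i ∪ₑ block (toℕ i) b) ∷ νRest b ≡ W (suc (toℕ i)) b
    W-μ-merge i b = cong (λ e → μRest (suc (toℕ i)) ++ e ∷ νRest b)
      (cong₂ _,_ (trans (∪-comm ⁅ i ⁆ _) (lower∪⁅⁆ i)) (∪-identityˡ _))

    W-end : ∀ {a b} → m ≤ a → n ≤ b → W a b ≡ block a b ∷ []
    W-end m≤a n≤b rewrite μRest-end m≤a | νRest-end n≤b = refl

    Pos-μEntry : ∀ i → Pos (μEntry i)
    Pos-μEntry i rewrite wt-⊥ ν | wt-⁅⁆ μ i = lookup⁺ μ⁺ i

    NonPos-νEntry : ∀ j → NonPos (νEntry j)
    NonPos-νEntry j rewrite wt-⊥ μ = n≮0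

    All-Pos-μRest : ∀ a → All Pos (μRest a)
    All-Pos-μRest a = All-reverse (drop⁺ a (tabulate⁺ Pos-μEntry))

    All-NonPos-νRest : ∀ b → All NonPos (νRest b)
    All-NonPos-νRest b = drop⁺ b (tabulate⁺ NonPos-νEntry)

    cov-νRest : ∀ b → cov (νRest b) ≡ (⊥ , ∁ (lower b))
    cov-νRest = down-induction _
      (λ b n≤b → trans (cong cov (νRest-end n≤b)) (cong (⊥ ,_) (sym (∁lower-≥ n≤b))))
      (λ j ih → trans (cong cov (νRest-step j))
        (cong₂ _,_ (trans (cong (⊥ ∪_) (cong proj₁ ih)) (∪-identityˡ ⊥))
                   (trans (cong (⁅ j ⁆ ∪_) (cong proj₂ ih)) (⁅⁆∪∁lower j))))

    cov-μRest : ∀ a → cov (μRest a) ≡ (∁ (lower a) , ⊥)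
    cov-μRest = down-induction _
      (λ a m≤a → trans (cong cov (μRest-end m≤a)) (cong (_, ⊥) (sym (∁lower-≥ m≤a))))
      (λ i ih → trans (cong cov (μRest-step i)) (trans (cov-++ (μRest (suc (toℕ i))) _)
        (cong₂ _,_ (trans (cong₂ _∪_ (cong proj₁ ih) (∪-identityʳ ⁅ i ⁆))
                     (trans (∪-comm _ ⁅ i ⁆) (⁅⁆∪∁lower i)))
                   (trans (cong₂ _∪_ (cong proj₂ ih) (∪-identityʳ ⊥)) (∪-identityʳ ⊥)))))

    PairwiseDisjoint-νRest : ∀ b → PairwiseDisjoint (νRest b)
    PairwiseDisjoint-νRest = down-induction _
      (λ b n≤b → subst PairwiseDisjoint (sym (νRest-end n≤b)) _)
      (λ j ih → subst PairwiseDisjoint (sym (νRest-step j))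
        (subst (νEntry j #_) (sym (cov-νRest (suc (toℕ j)))) ((λ _ → ∉⊥) , ⁅⁆#∁lower-suc j) , ih))

    PairwiseDisjoint-μRest : ∀ a → PairwiseDisjoint (μRest a)
    PairwiseDisjoint-μRest = down-induction _
      (λ a m≤a → subst PairwiseDisjoint (sym (μRest-end m≤a)) _)
      (λ i ih → subst PairwiseDisjoint (sym (μRest-step i))
        (PairwiseDisjoint-++ (μRest (suc (toℕ i))) (μEntry i ∷ []) ih (#-∅ , _)
          (subst (_# cov (μEntry i ∷ [])) (sym (cov-μRest (suc (toℕ i))))
            (#-∪ʳ ((λ x∈∁ x∈⁅i⁆ → ⁅⁆#∁lower-suc i x∈⁅i⁆ x∈∁) , (λ _ → ∉⊥)) #-∅))))

    Partition-W : ∀ {a} b → 1 ≤ a → Partition (W a b)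
    Partition-W {a} b 1≤a = disjoint , covers , occupied
      where
      block#νRest : block a b # cov (νRest b)
      block#νRest = subst (block a b #_) (sym (cov-νRest b)) ((λ _ → ∉⊥) , x∈p⇒x∉∁p)
      μRest#rest : cov (μRest a) # cov (block a b ∷ νRest b)
      μRest#rest = subst (_# cov (block a b ∷ νRest b)) (sym (cov-μRest a))
        (#-∪ʳ ((λ x∈∁ x∈ → x∈p⇒x∉∁p x∈ x∈∁) , (λ x∈⊥ → ⊥-elim (∉⊥ x∈⊥)))
              (subst (_ #_) (sym (cov-νRest b)) ((λ _ → ∉⊥) , (λ x∈⊥ → ⊥-elim (∉⊥ x∈⊥)))))
      disjoint : PairwiseDisjoint (W a b)
      disjoint = PairwiseDisjoint-++ (μRest a) (block a b ∷ νRest b) (PairwiseDisjoint-μRest a)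
        (block#νRest , PairwiseDisjoint-νRest b) μRest#rest
      covers : cov (W a b) ≡ (⊤ , ⊤)
      covers = begin
        cov (W a b)                                                ≡⟨ cov-++ (μRest a) _ ⟩
        cov (μRest a) ∪ₑ (block a b ∪ₑ cov (νRest b))
          ≡⟨ cong₂ (λ u v → u ∪ₑ (block a b ∪ₑ v)) (cov-μRest a) (cov-νRest b) ⟩
        (∁ (lower a) ∪ (lower a ∪ ⊥) , ⊥ ∪ (lower b ∪ ∁ (lower b)))
          ≡⟨ cong₂ _,_ lhs (trans (∪-identityˡ _) (p∪∁p≡⊤ (lower b))) ⟩
        (⊤ , ⊤)                                                    ∎
        where
        open ≡-Reasoning
        lhs : ∁ (lower a) ∪ (lower a ∪ ⊥) ≡ ⊤
        lhs = trans (cong (∁ (lower a) ∪_) (∪-identityʳ _))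
          (trans (∪-comm _ (lower a)) (p∪∁p≡⊤ (lower a)))
      occupied : All Occupied (W a b)
      occupied = ++⁺ (All-reverse (drop⁺ a (tabulate⁺ (λ i → inj₁ (i , x∈⁅x⁆ i)))))
        (inj₁ (lower-nonempty 1≤m 1≤a) ∷ drop⁺ b (tabulate⁺ (λ j → inj₂ (j , x∈⁅x⁆ j))))

    Reachable-W : ∀ {a} b → 1 ≤ a → Reachable (W a b)
    Reachable-W {a} b 1≤a = reachable _ (μRest a) [] (block a b) (νRest b) ≤-refl
      (Partition-W b 1≤a) (All-Pos-μRest a) [] (All-NonPos-νRest b) (inj₁ refl)

    νRest-⊆ : ∀ b → All (_⊆ₑ (⊥ , ∁ (lower b))) (νRest b)
    νRest-⊆ b = subst (λ c → All (_⊆ₑ c) (νRest b)) (cov-νRest b) (All-⊆ₑ-cov (νRest b))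

    -- Canceling block a b with ν_{b+1}, as φ does, versus passing it.
    module νStep (a : ℕ) (j : Fin n) where
      b : ℕ
      b = toℕ j
      passed : Word
      passed = μRest a ++ νEntry j ∷ block a b ∷ νRest (suc b)

      H : Subset n
      H = ∁ ⁅ j ⁆

      lower⊆H : lower b ⊆ H
      lower⊆H = subst (lower b ⊆_) (lower∪∁lower-suc j) (p⊆p∪q _)

      ∁lower⊆H : ∁ (lower (suc b)) ⊆ H
      ∁lower⊆H = subst (∁ (lower (suc b)) ⊆_) (lower∪∁lower-suc j) (q⊆p∪q (lower b) _)

      passed-dead : wt ν H < wt μ (lower a) → ∀ {q} → ¬ Reaches passed q
      passed-dead H<S = Doomed⇒¬Reaches (Doomed-intro (μRest a) (νEntry j) (block a b) (νRest (suc b))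
          ((λ x∈ → x∈) , lower⊆H)
          (All.map (λ (_ , J⊆) {x} x∈J → ∁lower⊆H (J⊆ x∈J)) (νRest-⊆ (suc b))))
        where open DoomedWords H (lower a) H<S

      Unique-step : Pos (block a b) → wt ν H < wt μ (lower a) → Unique (W a (suc b)) → Unique (W a b)
      Unique-step pb H<S u = subst Unique (sym (W-ν a j))
        (Unique-cancel (μRest a) (block a b) (νEntry j) (νRest (suc b)) pb
          (NonPos-νEntry j ∷ All-NonPos-νRest (suc b)) (passed-dead H<S) (subst Unique (sym (W-ν-merge a j)) u))

      Unique-next : Pos (block a b) → Unique (W a b) → Unique (W a (suc b))
      Unique-next pb u = subst Unique (W-ν-merge a j)
        (Unique-merge (μRest a) (block a b) (νEntry j) (νRest (suc b)) pb
          (NonPos-νEntry j ∷ All-NonPos-νRest (suc b)) (subst Unique (W-ν a j) u))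

      Unique⇒criterion : 1 ≤ a → Pos (block a b) → Unique (W a b) → wt ν H < wt μ (lower a)
      Unique⇒criterion 1≤a pb u with wt ν H <? wt μ (lower a)
      ... | yes H<S = H<S
      ... | no H≮S with cancels _ (μRest a) (νEntry j ∷ []) (block a b) (νRest (suc b)) ≤-refl
                          (Partition-swap (μRest a) (block a b) (νEntry j) (νRest (suc b))
                            (subst Partition (W-ν a j) (Partition-W b 1≤a)))
                          (All-Pos-μRest a) (NonPos-νEntry j ∷ []) pb (All-NonPos-νRest (suc b)) (inj₂ S<H)
        where
        S<H : Neg (cov (block a b ∷ νRest (suc b)))
        S<H = subst Neg (cong (block a b ∪ₑ_) (sym (cov-νRest (suc b))))
          (subst₂ _<_ (cong (wt μ) (sym (∪-identityʳ (lower a)))) (cong (wt ν) (sym (lower∪∁lower-suc j)))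
            (≤∧≢⇒< (≮⇒≥ H≮S) (chamber (lower a) H
              (λ (eq , _) → ∈⇒≢⊥ (proj₂ (lower-nonempty 1≤m 1≤a)) eq)
              (λ (_ , eq) → ∉⇒≢⊤ (x∈p⇒x∉∁p (x∈⁅x⁆ j)) eq))))
      ... | r , R , rest≡r∷R , q , reach
        with refl ← Unique-passing (μRest a) (block a b) (νEntry j) (νRest (suc b)) pb
                      (NonPos-νEntry j ∷ All-NonPos-νRest (suc b)) (subst Unique (W-ν a j) u)
                      (subst Reachable (sym (W-ν-merge a j)) (Reachable-W (suc b) 1≤a) .proj₂) reach
        = ⊥-elim (x∈p⇒x∉∁p (∈lower-suc j)
            (proj₂ (All.head (subst (All _) rest≡r∷R (νRest-⊆ (suc b)))) (x∈⁅x⁆ j)))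

    -- Canceling μ_{a+1} with block a b, as φ does, versus passing it.
    module μStep (i : Fin m) (b : ℕ) where
      a : ℕ
      a = toℕ i
      passed : Word
      passed = μRest (suc a) ++ block a b ∷ μEntry i ∷ νRest b

      H : Subset n
      H = ∁ (lower b)

      passed-dead : wt ν H < wt μ ⁅ i ⁆ → ∀ {q} → ¬ Reaches passed q
      passed-dead H<S = Doomed⇒¬Reaches (Doomed-intro (μRest (suc a)) (block a b) (μEntry i) (νRest b)
          ((λ x∈ → x∈) , (λ x∈⊥ → ⊥-elim (∉⊥ x∈⊥)))
          (All.map (λ (_ , J⊆) {x} → J⊆) (νRest-⊆ b)))
        where open DoomedWords H ⁅ i ⁆ H<S

      Unique-step : NonPos (block a b) → wt ν H < wt μ ⁅ i ⁆ → Unique (W (suc a) b) → Unique (W a b)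
      Unique-step npb H<S u = subst Unique (sym (W-μ i b))
        (Unique-cancel (μRest (suc a)) (μEntry i) (block a b) (νRest b) (Pos-μEntry i)
          (npb ∷ All-NonPos-νRest b) (passed-dead H<S) (subst Unique (sym (W-μ-merge i b)) u))

      Unique-next : NonPos (block a b) → Unique (W a b) → Unique (W (suc a) b)
      Unique-next npb u = subst Unique (W-μ-merge i b)
        (Unique-merge (μRest (suc a)) (μEntry i) (block a b) (νRest b) (Pos-μEntry i)
          (npb ∷ All-NonPos-νRest b) (subst Unique (W-μ i b) u))

      Unique⇒criterion : 1 ≤ a → NonPos (block a b) → Unique (W a b) → wt ν H < wt μ ⁅ i ⁆
      Unique⇒criterion 1≤a npb u with wt ν H <? wt μ ⁅ i ⁆
      ... | yes H<S = H<S
      ... | no H≮S with cancels _ (μRest (suc a)) (block a b ∷ []) (μEntry i) (νRest b) ≤-refl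
                          (Partition-swap (μRest (suc a)) (μEntry i) (block a b) (νRest b)
                            (subst Partition (W-μ i b) (Partition-W b 1≤a)))
                          (All-Pos-μRest (suc a)) (npb ∷ []) (Pos-μEntry i) (All-NonPos-νRest b) (inj₂ S<H)
        where
        S<H : Neg (cov (μEntry i ∷ νRest b))
        S<H = subst Neg (cong (μEntry i ∪ₑ_) (sym (cov-νRest b)))
          (subst₂ _<_ (cong (wt μ) (sym (∪-identityʳ ⁅ i ⁆))) (cong (wt ν) (sym (∪-identityˡ H)))
            (≤∧≢⇒< (≮⇒≥ H≮S) (chamber ⁅ i ⁆ H
              (λ (eq , _) → ∈⇒≢⊥ (x∈⁅x⁆ i) eq) (λ (eq , _) → ⁅⁆≢⊤ i 1≤a eq))))
      ... | r , R , rest≡r∷R , q , reach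
        with refl ← Unique-passing (μRest (suc a)) (μEntry i) (block a b) (νRest b) (Pos-μEntry i)
                      (npb ∷ All-NonPos-νRest b) (subst Unique (W-μ i b) u)
                      (subst Reachable (sym (W-μ-merge i b)) (Reachable-W b (s≤s z≤n)) .proj₂) reach
        = ⊥-elim (∉⊥ (proj₁ (All.head (subst (All _) rest≡r∷R (νRest-⊆ b)))
            (proj₂ (lower-nonempty 1≤m 1≤a))))

    ν-criterion : ∀ {a xs} (j : Fin n) {y} → drop a (toList μ) ≡ xs → V.lookup ν j ≡ y →
      sum xs < y ⇔ wt ν (∁ ⁅ j ⁆) < wt μ (lower a)
    ν-criterion {a} {xs} j {y} hx ν[j]≡y = +≡+⇒<⇔> (begin
      wt μ (lower a) + sum xs                 ≡⟨ cong (λ l → wt μ (lower a) + sum l) hx ⟨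
      wt μ (lower a) + sum (drop a (toList μ)) ≡⟨ wt-lower+drop μ a ⟩
      V.sum μ                                 ≡⟨ Σμ≡Σν ⟩
      V.sum ν                                 ≡⟨ wt-∪∁ ν ⁅ j ⁆ ⟨
      wt ν ⁅ j ⁆ + wt ν (∁ ⁅ j ⁆)             ≡⟨ +-comm (wt ν ⁅ j ⁆) _ ⟩
      wt ν (∁ ⁅ j ⁆) + wt ν ⁅ j ⁆             ≡⟨ cong (wt ν (∁ ⁅ j ⁆) +_) (trans (wt-⁅⁆ ν j) ν[j]≡y) ⟩
      wt ν (∁ ⁅ j ⁆) + y                      ∎)
      where open ≡-Reasoning

    μ-criterion : ∀ {b ys} (i : Fin m) {x} → drop b (toList ν) ≡ ys → V.lookup μ i ≡ x →
      sum ys < x ⇔ wt ν (∁ (lower b)) < wt μ ⁅ i ⁆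
    μ-criterion {b} i hy μ[i]≡x rewrite wt-∁lower ν b | hy | wt-⁅⁆ μ i | μ[i]≡x = ⇔.refl

    -- At W a b the next part of φ sits at list position a + b.
    data Greedy (a b : ℕ) : Set where
      finish : m ≤ a → n ≤ b → length (φ μ ν) ≤ a + b → Greedy a b
      stepν : (j : Fin n) → toℕ j ≡ b → Pos (block a b) →
        PhiAt μ ν (a + b) ⇔ wt ν (∁ ⁅ j ⁆) < wt μ (lower a) → Greedy a (suc b) → Greedy a b
      stepμ : (i : Fin m) → toℕ i ≡ a → NonPos (block a b) →
        PhiAt μ ν (a + b) ⇔ wt ν (∁ (lower b)) < wt μ ⁅ i ⁆ → Greedy (suc a) b → Greedy a b

    Greedy⇒Unique : ∀ {a b} → Greedy a b → (∀ k → 1 ≤ k → PhiAt μ ν k) → 1 ≤ a → Unique (W a b)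
    Greedy⇒Unique (finish m≤a n≤b _) _ _ =
      subst Unique (sym (W-end m≤a n≤b)) λ r r′ → trans (Reaches-[-] r) (sym (Reaches-[-] r′))
    Greedy⇒Unique {a} (stepν j refl pb crit g) phi 1≤a =
      νStep.Unique-step a j pb (Equivalence.to crit (phi _ (≤-trans 1≤a (m≤m+n a _))))
        (Greedy⇒Unique g phi 1≤a)
    Greedy⇒Unique {b = b} (stepμ i refl npb crit g) phi 1≤a =
      μStep.Unique-step i b npb (Equivalence.to crit (phi _ (≤-trans 1≤a (m≤m+n _ b))))
        (Greedy⇒Unique g phi (s≤s z≤n))

    Greedy⇒PhiAt : ∀ {a b} → Greedy a b → 1 ≤ a → Unique (W a b) → ∀ k → a + b ≤ k → PhiAt μ ν k
    Greedy⇒PhiAt (finish _ _ len≤) _ _ k a+b≤k = PhiAt-[] μ ν (≤-trans len≤ a+b≤k)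
    Greedy⇒PhiAt {a} (stepν j refl pb crit g) 1≤a u k a+b≤k with m≤n⇒m<n∨m≡n a+b≤k
    ... | inj₂ refl = Equivalence.from crit (νStep.Unique⇒criterion a j 1≤a pb u)
    ... | inj₁ a+b<k = Greedy⇒PhiAt g 1≤a (νStep.Unique-next a j pb u) k (subst (_≤ k) (sym (+-suc a _)) a+b<k)
    Greedy⇒PhiAt {b = b} (stepμ i refl npb crit g) 1≤a u k a+b≤k with m≤n⇒m<n∨m≡n a+b≤k
    ... | inj₂ refl = Equivalence.from crit (μStep.Unique⇒criterion i b 1≤a npb u)
    ... | inj₁ a+b<k = Greedy⇒PhiAt g (s≤s z≤n) (μStep.Unique-next i b npb u) k a+b<k

    ν-step : ∀ a b {xs y ys} → drop a (toList μ) ≡ xs → drop b (toList ν) ≡ y ∷ ys → Pos (block a b) →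
      drop (a + b) (φ μ ν) ≡ (νside , y) ∷ go xs ys (wt μ (lower a)) (wt ν (lower b) + y) →
      Greedy a (suc b) → Greedy a b
    ν-step a b {xs} {y} {ys} hx hy pb hφ g with drop-toList ν b hy
    ... | j , refl , ν[j]≡y = stepν j refl pb
      (⇔.trans (PhiAt-ν μ ν (a + toℕ j) xs ys _ _ hφ) (ν-criterion {a} j hx ν[j]≡y)) g

    μ-step : ∀ a b {x xs ys} → drop a (toList μ) ≡ x ∷ xs → drop b (toList ν) ≡ ys → NonPos (block a b) →
      drop (a + b) (φ μ ν) ≡ (μside , x) ∷ go xs ys (wt μ (lower a) + x) (wt ν (lower b)) →
      Greedy (suc a) b → Greedy a b
    μ-step a b {x} {xs} {ys} hx hy npb hφ g with drop-toList μ a hx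
    ... | i , refl , μ[i]≡x = stepμ i refl npb
      (⇔.trans (PhiAt-μ μ ν (toℕ i + b) xs ys _ _ hφ) (μ-criterion {b} i hy μ[i]≡x)) g

    φ-after-ν : ∀ a b {xs y ys sa} → drop b (toList ν) ≡ y ∷ ys →
      drop (a + b) (φ μ ν) ≡ (νside , y) ∷ go xs ys sa (wt ν (lower b) + y) →
      drop (a + suc b) (φ μ ν) ≡ go xs ys sa (wt ν (lower (suc b)))
    φ-after-ν a b {xs} {y} {ys} {sa} hy hφ = trans (cong (λ k → drop k (φ μ ν)) (+-suc a b))
      (trans (drop-suc (φ μ ν) (a + b) hφ) (cong (go xs ys sa) (sym (wt-lower-suc ν b hy))))

    φ-after-μ : ∀ a b {x xs ys sb} → drop a (toList μ) ≡ x ∷ xs →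
      drop (a + b) (φ μ ν) ≡ (μside , x) ∷ go xs ys (wt μ (lower a) + x) sb →
      drop (suc a + b) (φ μ ν) ≡ go xs ys (wt μ (lower (suc a))) sb
    φ-after-μ a b {x} {xs} {ys} {sb} hx hφ =
      trans (drop-suc (φ μ ν) (a + b) hφ) (cong (λ s → go xs ys s sb) (sym (wt-lower-suc μ a hx)))

    Pos-block-μ-exhausted : ∀ a b {y ys} → drop a (toList μ) ≡ [] → drop b (toList ν) ≡ y ∷ ys →
      Pos (block a b)
    Pos-block-μ-exhausted a b {y} {ys} hx hy = begin-strict
      wt ν (lower b)                           <⟨ m<m+n _ (<-≤-trans (ν-part>0 (drop-toList ν b hy)) (m≤m+n y _)) ⟩
      wt ν (lower b) + sum (y ∷ ys)            ≡⟨ cong (λ l → wt ν (lower b) + sum l) hy ⟨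
      wt ν (lower b) + sum (drop b (toList ν)) ≡⟨ wt-lower+drop ν b ⟩
      V.sum ν                                  ≡⟨ Σμ≡Σν ⟨
      V.sum μ                                  ≡⟨ wt-lower+drop μ a ⟨
      wt μ (lower a) + sum (drop a (toList μ)) ≡⟨ cong (λ l → wt μ (lower a) + sum l) hx ⟩
      wt μ (lower a) + 0                       ≡⟨ +-identityʳ _ ⟩
      wt μ (lower a)                           ∎
      where
      open ≤-Reasoning
      ν-part>0 : Σ (Fin n) (λ j → toℕ j ≡ b × V.lookup ν j ≡ y) → 0 < y
      ν-part>0 (j , _ , ν[j]≡y) = subst (0 <_) ν[j]≡y (lookup⁺ ν⁺ j)

    NonPos-block-ν-exhausted : ∀ a b → drop b (toList ν) ≡ [] → NonPos (block a b)
    NonPos-block-ν-exhausted a b hy = flip <⇒≱ (begin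
      wt μ (lower a)                           ≤⟨ m≤m+n _ _ ⟩
      wt μ (lower a) + sum (drop a (toList μ)) ≡⟨ wt-lower+drop μ a ⟩
      V.sum μ                                  ≡⟨ Σμ≡Σν ⟩
      V.sum ν                                  ≡⟨ wt-lower+drop ν b ⟨
      wt ν (lower b) + sum (drop b (toList ν)) ≡⟨ cong (λ l → wt ν (lower b) + sum l) hy ⟩
      wt ν (lower b) + 0                       ≡⟨ +-identityʳ _ ⟩
      wt ν (lower b)                           ∎)
      where open ≤-Reasoning

    greedy : ∀ a b xs ys → drop a (toList μ) ≡ xs → drop b (toList ν) ≡ ys →
      drop (a + b) (φ μ ν) ≡ go xs ys (wt μ (lower a)) (wt ν (lower b)) → Greedy a b
    greedy a b [] [] hx hy hφ = finish
      (subst (_≤ a) (length-toList μ) (drop≡[]⇒length≤ (toList μ) a hx))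
      (subst (_≤ b) (length-toList ν) (drop≡[]⇒length≤ (toList ν) b hy))
      (drop≡[]⇒length≤ (φ μ ν) (a + b) hφ)
    greedy a b [] (y ∷ ys) hx hy hφ = ν-step a b hx hy (Pos-block-μ-exhausted a b hx hy) hφ
      (greedy a (suc b) [] ys hx (drop-suc (toList ν) b hy) (φ-after-ν a b {xs = []} {sa = wt μ (lower a)} hy hφ))
    greedy a b (x ∷ xs) [] hx hy hφ = μ-step a b hx hy (NonPos-block-ν-exhausted a b hy) hφ
      (greedy (suc a) b xs [] (drop-suc (toList μ) a hx) hy (φ-after-μ a b {ys = []} {sb = wt ν (lower b)} hx hφ))
    greedy a b (x ∷ xs) (y ∷ ys) hx hy hφ = branch (wt ν (lower b) <ᵇ wt μ (lower a)) refl
      (λ hφν → greedy a (suc b) (x ∷ xs) ys hx (drop-suc (toList ν) b hy)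
        (φ-after-ν a b {xs = x ∷ xs} {sa = wt μ (lower a)} hy hφν))
      (λ hφμ → greedy (suc a) b xs (y ∷ ys) (drop-suc (toList μ) a hx) hy
        (φ-after-μ a b {ys = y ∷ ys} {sb = wt ν (lower b)} hx hφμ))
      where
      sa sb : ℕ
      sa = wt μ (lower a)
      sb = wt ν (lower b)
      branch : ∀ c → (sb <ᵇ sa) ≡ c →
        (drop (a + b) (φ μ ν) ≡ (νside , y) ∷ go (x ∷ xs) ys sa (sb + y) → Greedy a (suc b)) →
        (drop (a + b) (φ μ ν) ≡ (μside , x) ∷ go xs (y ∷ ys) (sa + x) sb → Greedy (suc a) b) →
        Greedy a b
      branch true lt kν _ = ν-step a b hx hy (<ᵇ⇒< _ _ (subst T (sym lt) _)) hφν (kν hφν)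
        where
        hφν : drop (a + b) (φ μ ν) ≡ (νside , y) ∷ go (x ∷ xs) ys sa (sb + y)
        hφν = trans hφ (go-ν {x} {xs} {y} {ys} lt)
      branch false ≮ _ kμ = μ-step a b hx hy (λ lt → subst T ≮ (<⇒<ᵇ lt)) hφμ (kμ hφμ)
        where
        hφμ : drop (a + b) (φ μ ν) ≡ (μside , x) ∷ go xs (y ∷ ys) (sa + x) sb
        hφμ = trans hφ (go-μ {x} {xs} {y} {ys} ≮)

  module Initial {m n : ℕ} (x₀ : ℕ) (μ′ : Vec ℕ m) (y₀ : ℕ) (ν′ : Vec ℕ n)
    (μ⁺ : VAll (0 <_) (x₀ ∷ μ′)) (ν⁺ : VAll (0 <_) (y₀ ∷ ν′))
    (Σμ≡Σν : V.sum (x₀ ∷ μ′) ≡ V.sum (y₀ ∷ ν′))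
    (chamber : Chamber (x₀ ∷ μ′) (y₀ ∷ ν′)) where

    μ : Vec ℕ (suc m)
    μ = x₀ ∷ μ′

    ν : Vec ℕ (suc n)
    ν = y₀ ∷ ν′

    open Moves μ ν
    open Walk μ ν (s≤s z≤n) μ⁺ ν⁺ Σμ≡Σν chamber

    initialWord≡W : initialWord ≡ W 1 0
    initialWord≡W = begin
      reverse (Data.List.map μEntry (allFin _)) ++ Data.List.map νEntry (allFin _)
        ≡⟨ cong₂ (λ u v → reverse u ++ v) (map-tabulate id μEntry) (map-tabulate id νEntry) ⟩
      μRest 0 ++ νRest 0                     ≡⟨ cong (_++ νRest 0) (μRest-step zero) ⟩
      (μRest 1 ++ μEntry zero ∷ []) ++ νRest 0 ≡⟨ ++-assoc (μRest 1) _ _ ⟩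
      W 1 0                                   ∎
      where open ≡-Reasoning

    firstTwo : Bool → List (Side × ℕ)
    firstTwo c = if c then (μside , x₀) ∷ (νside , y₀) ∷ [] else (νside , y₀) ∷ (μside , x₀) ∷ []

    G : List (Side × ℕ)
    G = go (toList μ′) (toList ν′) x₀ y₀

    φ-start : drop 2 (φ μ ν) ≡ go (toList μ′) (toList ν′) (wt μ (lower 1)) (wt ν (lower 1))
    φ-start = trans (drop-firstTwo (y₀ <ᵇ x₀))
      (sym (cong₂ (go (toList μ′) (toList ν′)) (wt-⁅⁆ μ zero) (wt-⁅⁆ ν zero)))
      where
      drop-firstTwo : ∀ c → drop 2 (firstTwo c ++ G) ≡ G
      drop-firstTwo true = refl
      drop-firstTwo false = refl

    φ₂-criterion : PhiAt μ ν 1 ⇔ wt ν (∁ ⁅ zero ⁆) < wt μ (lower 1)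
    φ₂-criterion = by (y₀ <ᵇ x₀) refl
      where
      drop1-φ : ∀ {c} → (y₀ <ᵇ x₀) ≡ c → drop 1 (φ μ ν) ≡ drop 1 (firstTwo c ++ G)
      drop1-φ = cong (λ c → drop 1 (firstTwo c ++ G))
      by : ∀ c → (y₀ <ᵇ x₀) ≡ c → PhiAt μ ν 1 ⇔ wt ν (∁ ⁅ zero ⁆) < wt μ (lower 1)
      by true eq =
        ⇔.trans (PhiAt-ν μ ν 1 (toList μ′) (toList ν′) x₀ y₀ (drop1-φ eq)) (ν-criterion {1} zero refl refl)
      by false eq =
        ⇔.trans (PhiAt-μ μ ν 1 (toList μ′) (toList ν′) x₀ y₀ (drop1-φ eq)) (μ-criterion {1} zero refl refl)

    greedy-start : Greedy 1 0
    greedy-start = stepν zero refl (Pos-μEntry zero) φ₂-criterion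
      (greedy 1 1 (toList μ′) (toList ν′) refl refl φ-start)

    Unique-initial⇔PhiAt : Unique (W 1 0) ⇔ (∀ k → 1 ≤ k → PhiAt μ ν k)
    Unique-initial⇔PhiAt =
      mk⇔ (Greedy⇒PhiAt greedy-start (s≤s z≤n)) (λ phi → Greedy⇒Unique greedy-start phi (s≤s z≤n))

    Unique-initial⇔CPSingleton : Unique (W 1 0) ⇔ CPSingleton μ ν
    Unique-initial⇔CPSingleton = mk⇔ to from
      where
      toW : ∀ {q} → Reaches initialWord q → Reaches (W 1 0) q
      toW = subst (λ w → Reaches w _) initialWord≡W
      fromW : ∀ {q} → Reaches (W 1 0) q → Reaches initialWord q
      fromW = subst (λ w → Reaches w _) (sym initialWord≡W)
      to : Unique (W 1 0) → CPSingleton μ ν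
      to u with q , r ← Reachable-W 0 (s≤s z≤n) = q , fromW r , λ q′ r′ → u (toW r′) r
      from : CPSingleton μ ν → Unique (W 1 0)
      from (_ , _ , uniq) r r′ = trans (uniq _ (fromW r)) (sym (uniq _ (fromW r′)))

open CommutationPatterns using (module Initial; PhiCondition⇔PhiAt)
open import Data.Nat using (ℕ; _≤_; _<_; suc)
open import Data.Vec using (Vec; sum; _∷_)
open import Data.Vec.Relation.Unary.All using (All)
open import Function.Bundles using (_⇔_)
import Function.Properties.Equivalence as ⇔
open import Relation.Binary.PropositionalEquality using (_≡_)

lemma4p4 : (m n : ℕ) → 1 ≤ m → 1 ≤ n →
    (μ : Vec ℕ m) (ν : Vec ℕ n) →
    All (0 <_) μ → All (0 <_) ν →
    sum μ ≡ sum ν →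
    Chamber μ ν →
    CPSingleton μ ν ⇔ PhiCondition μ ν
lemma4p4 (suc m) (suc n) _ _ (x₀ ∷ μ′) (y₀ ∷ ν′) μ⁺ ν⁺ Σμ≡Σν chamber =
  ⇔.trans (⇔.sym Unique-initial⇔CPSingleton)
    (⇔.trans Unique-initial⇔PhiAt (⇔.sym (PhiCondition⇔PhiAt (x₀ ∷ μ′) (y₀ ∷ ν′))))
  where open Initial x₀ μ′ y₀ ν′ μ⁺ ν⁺ Σμ≡Σν chamber
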